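{- There is an absolute constant $C$ such that for all $0\le m<n$, with $k=n-m$, the peak lists of the U-MMB with $m$ leaves and with $n$ leaves differ in at most $C(1+\log_2 k)$ peaks, i.e., the number of peaks present in exactly one of the two structures is $O(\log k)$.
   Context: A mountain of height $s\ge0$ is a perfect binary tree with $2^s$ leaves; its root is its peak. The U-MMB with $n$ leaves is an ordered (left-to-right) list of mountains whose leaves read left to right are $h_1,\dots,h_n$, defined inductively from the empty list: the $n$-th append (1) adds $h_n$ as a height-0 mountain at the right end, and (2) if there exist two consecutive mountains of equal height, takes the rightmost such pair, of height $s$, and replaces it in place by a mountain of height $s+1$ whose new peak has the two old peaks as children. Nodes are never modified once created (a node is identified by its set of descendant leaves). The commitment $\langle X_n\rangle$ is the list of peak hashes; the paper phrases the claim as "$\langle X_m\rangle$ and $\langle X_n\rangle$ differ in only $O(\log k)$ hashes". -}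

module Defs where

open import Data.Nat using (ℕ; zero; suc; _+_; _≟_)
open import Data.Nat.Properties using () renaming (_≟_ to _≟ℕ_)
open import Data.Product using (_×_; _,_; proj₁; proj₂)
open import Data.Product.Properties using (≡-dec)
open import Data.List using (List; []; _∷_; _++_; [_]; length; filter)
open import Data.List.Membership.Propositional using (_∈_)
import Data.List.Membership.DecPropositional as DecMem
open import Data.Maybe using (Maybe; just; nothing)
open import Relation.Nullary using (Dec; yes; no; ¬?)
open import Relation.Binary.PropositionalEquality using (_≡_)

-- A node of the U-MMB is identified by its set of descendant leaves, which
-- is always a contiguous block of leaf indices [start, start + 2^height).
-- We therefore represent a mountain (identified by its peak) by the pair
-- (start , height), with leaves h_start, …, h_{start + 2^height - 1}
-- (leaves indexed from 0).
Mountain : Set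
Mountain = ℕ × ℕ

start : Mountain → ℕ
start = proj₁

height : Mountain → ℕ
height = proj₂

_≟M_ : (x y : Mountain) → Dec (x ≡ y)
_≟M_ = ≡-dec _≟ℕ_ _≟ℕ_

mergeRightmost : List Mountain → Maybe (List Mountain)
mergeRightmost [] = nothing
mergeRightmost (x ∷ []) = nothing
mergeRightmost (x ∷ y ∷ ys) with mergeRightmost (y ∷ ys)
... | just zs = just (x ∷ zs)
... | nothing with height x ≟ℕ height y
...   | yes _ = just ((start x , suc (height x)) ∷ ys)
...   | no _ = nothing

appendLeaf : ℕ → List Mountain → List Mountain
appendLeaf n xs with mergeRightmost (xs ++ [ (n , 0) ])
... | just zs = zs
... | nothing = xs ++ [ (n , 0) ]

UMMB : ℕ → List Mountain
UMMB zero = []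
UMMB (suc n) = appendLeaf n (UMMB n)

_∈?M_ : (x : Mountain) (xs : List Mountain) → Dec (x ∈ xs)
_∈?M_ = DecMem._∈?_ _≟M_

onlyIn : List Mountain → List Mountain → ℕ
onlyIn xs ys = length (filter (λ x → ¬? (x ∈?M ys)) xs)

peakDiff : List Mountain → List Mountain → ℕ
peakDiff xs ys = onlyIn xs ys + onlyIn ys xs

{-# OPTIONS --safe #-}
module Submission where

-- Pairing leaves 2i and 2i+1 makes the U-MMB self-similar: with 2j+1 leaves it is the
-- U-MMB with j leaves with every mountain dilated (start doubled, one level higher),
-- followed by leaf 2j; with 2j+2 leaves it is the dilation of the U-MMB with j leaves
-- followed by the still unmerged leaf j.  Indexing the U-MMB by binary numerals ℕᵇ
-- turns this into a structural recursion.  Dilation preserves peak differences, so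
-- replacing m and n by ⌊(m-1)/2⌋ and ⌊(n-1)/2⌋ loses at most 2 peaks while halving
-- the gap.  Once the gap is at most 1 the difference is at most 4, as one append
-- performs a single merge.  Hence a gap of at most 2^e costs at most 4 + 2e peaks.

open import Defs
open import Data.Nat using (ℕ; _+_; _*_; _∸_; _≤_; _<_; zero; suc; pred; ⌊_/2⌋; _^_; z≤n; s≤s; s≤s⁻¹)
open import Data.Nat.Logarithm using (⌊log₂_⌋; ⌊log₂⌋-mono-≤; ⌊log₂[2^n]⌋≡n)
open import Data.Product using (∃-syntax; _,_)

open import Algebra.Properties.CommutativeSemigroup using (interchange)
open import Data.Empty using (⊥-elim)
open import Data.List using (List; []; _∷_; _++_; [_]; length; filter; map)
open import Data.List.Membership.Propositional using (_∈_)
open import Data.List.Membership.Propositional.Properties using (∈-++⁺ˡ; ∈-++⁺ʳ; ∈-map⁺; ∈-map⁻)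
open import Data.List.Properties
  using (length-++; filter-++; length-filter; filter-none; filter-reject; map-++; ++-assoc; ++-identityʳ)
open import Data.List.Relation.Binary.Subset.Propositional using (_⊆_)
import Data.List.Relation.Unary.All as All
open import Data.List.Relation.Unary.Any using (here; there)
open import Data.Maybe as Maybe using (just; nothing; fromMaybe)
open import Data.Nat.Binary.Base as Bin using (ℕᵇ; 2[1+_]; 1+[2_]; toℕ; fromℕ')
open import Data.Nat.Binary.Properties using (toℕ-injective; toℕ-suc; toℕ-fromℕ')
open import Data.Nat.Properties
open import Data.Sum using (inj₁; inj₂)
open import Function.Definitions using (Injective)
open import Relation.Nullary using (yes; no; ¬?)
open import Relation.Binary.PropositionalEquality
  using (_≡_; refl; sym; trans; cong; cong₂; subst; module ≡-Reasoning)

⌊2m+n/2⌋≡m+⌊n/2⌋ : ∀ m n → ⌊ 2 * m + n /2⌋ ≡ m + ⌊ n /2⌋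
⌊2m+n/2⌋≡m+⌊n/2⌋ zero    n = refl
⌊2m+n/2⌋≡m+⌊n/2⌋ (suc m) n =
  trans (cong (λ k → ⌊ k + n /2⌋) (*-suc 2 m)) (cong suc (⌊2m+n/2⌋≡m+⌊n/2⌋ m n))

pred[m+n]≤m+pred[n] : ∀ m n → pred (m + n) ≤ m + pred n
pred[m+n]≤m+pred[n] m zero    = pred[n]≤n
pred[m+n]≤m+pred[n] m (suc n) = ≤-reflexive (cong pred (+-suc m n))

n<2^[1+⌊log₂n⌋] : ∀ n → n < 2 ^ suc ⌊log₂ n ⌋
n<2^[1+⌊log₂n⌋] n = ≰⇒> λ 2^≤n →
  1+n≰n (subst (_≤ ⌊log₂ n ⌋) (⌊log₂[2^n]⌋≡n (suc ⌊log₂ n ⌋)) (⌊log₂⌋-mono-≤ 2^≤n))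

onlyIn-++ : ∀ xs ys zs → onlyIn (xs ++ ys) zs ≡ onlyIn xs zs + onlyIn ys zs
onlyIn-++ xs ys zs = trans (cong length (filter-++ (λ x → ¬? (x ∈?M zs)) xs ys)) (length-++ (filter _ xs))

onlyIn≤length : ∀ xs zs → onlyIn xs zs ≤ length xs
onlyIn≤length xs zs = length-filter (λ x → ¬? (x ∈?M zs)) xs

onlyIn-⊆ : ∀ xs {zs} → xs ⊆ zs → onlyIn xs zs ≡ 0
onlyIn-⊆ xs {zs} xs⊆zs =
  cong length (filter-none (λ x → ¬? (x ∈?M zs)) (All.tabulate λ x∈xs x∉zs → x∉zs (xs⊆zs x∈xs)))

onlyIn-∷-∈ : ∀ {x} xs {zs} → x ∈ zs → onlyIn (x ∷ xs) zs ≡ onlyIn xs zs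
onlyIn-∷-∈ xs {zs} x∈zs = cong length (filter-reject (λ x → ¬? (x ∈?M zs)) λ x∉zs → x∉zs x∈zs)

onlyIn-antitone : ∀ {ys zs} → ys ⊆ zs → ∀ xs → onlyIn xs zs ≤ onlyIn xs ys
onlyIn-antitone ys⊆zs [] = z≤n
onlyIn-antitone {ys} {zs} ys⊆zs (x ∷ xs) with x ∈?M ys | x ∈?M zs
... | yes _ | yes _ = onlyIn-antitone ys⊆zs xs
... | no _  | yes _ = m≤n⇒m≤1+n (onlyIn-antitone ys⊆zs xs)
... | no _  | no _  = s≤s (onlyIn-antitone ys⊆zs xs)
... | yes p | no ¬q = ⊥-elim (¬q (ys⊆zs p))

onlyIn-map : ∀ {f : Mountain → Mountain} → Injective _≡_ _≡_ f →
             ∀ xs ys → onlyIn (map f xs) (map f ys) ≡ onlyIn xs ys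
onlyIn-map f-inj [] ys = refl
onlyIn-map {f} f-inj (x ∷ xs) ys with x ∈?M ys | f x ∈?M map f ys
... | yes _ | yes _ = onlyIn-map f-inj xs ys
... | no _  | no _  = cong suc (onlyIn-map f-inj xs ys)
... | yes p | no ¬q = ⊥-elim (¬q (∈-map⁺ f p))
... | no ¬p | yes q with ∈-map⁻ f q
...   | y , y∈ys , fx≡fy = ⊥-elim (¬p (subst (_∈ ys) (sym (f-inj fx≡fy)) y∈ys))

peakDiff-self : ∀ xs → peakDiff xs xs ≡ 0
peakDiff-self xs = cong₂ _+_ none none
  where
  none : onlyIn xs xs ≡ 0
  none = onlyIn-⊆ xs λ x∈xs → x∈xs

peakDiff-map : ∀ {f : Mountain → Mountain} → Injective _≡_ _≡_ f →
               ∀ xs ys → peakDiff (map f xs) (map f ys) ≡ peakDiff xs ys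
peakDiff-map f-inj xs ys = cong₂ _+_ (onlyIn-map f-inj xs ys) (onlyIn-map f-inj ys xs)

peakDiff-∷ : ∀ x xs ys → peakDiff (x ∷ xs) (x ∷ ys) ≤ peakDiff xs ys
peakDiff-∷ x xs ys = +-mono-≤ (drop xs ys) (drop ys xs)
  where
  drop : ∀ us vs → onlyIn (x ∷ us) (x ∷ vs) ≤ onlyIn us vs
  drop us vs = ≤-trans (≤-reflexive (onlyIn-∷-∈ {x} us {x ∷ vs} (here refl))) (onlyIn-antitone there us)

peakDiff-++ˡ : ∀ ts us xs → peakDiff (ts ++ xs) (us ++ xs) ≤ length ts + length us
peakDiff-++ˡ ts us xs = +-mono-≤ (bound ts us) (bound us ts)
  where
  open ≤-Reasoning
  bound : ∀ vs ws → onlyIn (vs ++ xs) (ws ++ xs) ≤ length vs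
  bound vs ws = begin
    onlyIn (vs ++ xs) (ws ++ xs)                  ≡⟨ onlyIn-++ vs xs (ws ++ xs) ⟩
    onlyIn vs (ws ++ xs) + onlyIn xs (ws ++ xs)   ≡⟨ cong (onlyIn vs (ws ++ xs) +_) (onlyIn-⊆ xs (∈-++⁺ʳ ws)) ⟩
    onlyIn vs (ws ++ xs) + 0                      ≡⟨ +-identityʳ _ ⟩
    onlyIn vs (ws ++ xs)                          ≤⟨ onlyIn≤length vs _ ⟩
    length vs                                     ∎

peakDiff-++ʳ : ∀ xs ts ys us → peakDiff (xs ++ ts) (ys ++ us) ≤ peakDiff xs ys + (length ts + length us)
peakDiff-++ʳ xs ts ys us = begin
    onlyIn (xs ++ ts) (ys ++ us) + onlyIn (ys ++ us) (xs ++ ts)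
      ≤⟨ +-mono-≤ (bound xs ts ys us) (bound ys us xs ts) ⟩
    (onlyIn xs ys + length ts) + (onlyIn ys xs + length us)
      ≡⟨ interchange +-commutativeSemigroup (onlyIn xs ys) (length ts) (onlyIn ys xs) (length us) ⟩
    peakDiff xs ys + (length ts + length us) ∎
  where
  open ≤-Reasoning
  bound : ∀ vs rs ws ss → onlyIn (vs ++ rs) (ws ++ ss) ≤ onlyIn vs ws + length rs
  bound vs rs ws ss = begin
    onlyIn (vs ++ rs) (ws ++ ss)                  ≡⟨ onlyIn-++ vs rs (ws ++ ss) ⟩
    onlyIn vs (ws ++ ss) + onlyIn rs (ws ++ ss)   ≤⟨ +-mono-≤ (onlyIn-antitone ∈-++⁺ˡ vs) (onlyIn≤length rs _) ⟩
    onlyIn vs ws + length rs                      ∎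

dilate : Mountain → Mountain
dilate x = 2 * start x , suc (height x)

dilate-injective : Injective _≡_ _≡_ dilate
dilate-injective eq = cong₂ _,_ (*-cancelˡ-≡ _ _ 2 (cong start eq)) (suc-injective (cong height eq))

mergeStep : List Mountain → List Mountain
mergeStep xs = fromMaybe xs (mergeRightmost xs)

appendLeaf≡mergeStep : ∀ n xs → appendLeaf n xs ≡ mergeStep (xs ++ [ (n , 0) ])
appendLeaf≡mergeStep n xs with mergeRightmost (xs ++ [ (n , 0) ])
... | just _  = refl
... | nothing = refl

peakDiff-mergeRightmost : ∀ xs {ys} → mergeRightmost xs ≡ just ys → peakDiff xs ys ≤ 3
peakDiff-mergeRightmost []           ()
peakDiff-mergeRightmost (x ∷ [])     ()
peakDiff-mergeRightmost (x ∷ y ∷ xs) eq with mergeRightmost (y ∷ xs) in merged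
peakDiff-mergeRightmost (x ∷ y ∷ xs) refl | just zs =
  ≤-trans (peakDiff-∷ x (y ∷ xs) zs) (peakDiff-mergeRightmost (y ∷ xs) merged)
peakDiff-mergeRightmost (x ∷ y ∷ xs) eq | nothing with height x ≟ height y
peakDiff-mergeRightmost (x ∷ y ∷ xs) refl | nothing | yes _ = peakDiff-++ˡ (x ∷ y ∷ []) [ _ ] xs
peakDiff-mergeRightmost (x ∷ y ∷ xs) ()   | nothing | no _

peakDiff-mergeStep : ∀ xs → peakDiff xs (mergeStep xs) ≤ 3
peakDiff-mergeStep xs with mergeRightmost xs in merged
... | just _  = peakDiff-mergeRightmost xs merged
... | nothing = ≤-trans (≤-reflexive (peakDiff-self xs)) z≤n

mergeRightmost-leaves : ∀ xs s t → mergeRightmost (xs ++ (s , 0) ∷ (t , 0) ∷ []) ≡ just (xs ++ [ (s , 1) ])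
mergeRightmost-leaves []           s t = refl
mergeRightmost-leaves (x ∷ [])     s t = refl
mergeRightmost-leaves (x ∷ y ∷ xs) s t rewrite mergeRightmost-leaves (y ∷ xs) s t = refl

mergeRightmost-dilate : ∀ xs s → mergeRightmost (map dilate xs ++ [ (s , 0) ]) ≡
                        Maybe.map (λ ys → map dilate ys ++ [ (s , 0) ]) (mergeRightmost xs)
mergeRightmost-dilate []           s = refl
mergeRightmost-dilate (x ∷ [])     s = refl
mergeRightmost-dilate (x ∷ y ∷ xs) s rewrite mergeRightmost-dilate (y ∷ xs) s with mergeRightmost (y ∷ xs)
... | just _  = refl
... | nothing with height x ≟ height y | suc (height x) ≟ suc (height y)
...   | yes _  | yes _  = refl
...   | no _   | no _   = refl
...   | yes eq | no neq = ⊥-elim (neq (cong suc eq))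
...   | no neq | yes eq = ⊥-elim (neq (suc-injective eq))

mergeStep-dilate : ∀ xs s → mergeStep (map dilate xs ++ [ (s , 0) ]) ≡ map dilate (mergeStep xs) ++ [ (s , 0) ]
mergeStep-dilate xs s rewrite mergeRightmost-dilate xs s with mergeRightmost xs
... | just _  = refl
... | nothing = refl

UMMBᵇ : ℕᵇ → List Mountain
UMMBᵇ Bin.zero    = []
UMMBᵇ 1+[2 j ]    = map dilate (UMMBᵇ j) ++ [ (2 * toℕ j , 0) ]
UMMBᵇ 2[1+ j ]    = map dilate (UMMBᵇ j ++ [ (toℕ j , 0) ])

appendLeaf-UMMBᵇ : ∀ b → appendLeaf (toℕ b) (UMMBᵇ b) ≡ UMMBᵇ (Bin.suc b)
appendLeaf-UMMBᵇ Bin.zero = refl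
appendLeaf-UMMBᵇ 1+[2 j ] = begin
  appendLeaf (suc s) (ds ++ [ (s , 0) ])           ≡⟨ appendLeaf≡mergeStep (suc s) (ds ++ [ (s , 0) ]) ⟩
  mergeStep ((ds ++ [ (s , 0) ]) ++ [ (suc s , 0) ]) ≡⟨ cong mergeStep (++-assoc ds [ (s , 0) ] [ (suc s , 0) ]) ⟩
  mergeStep (ds ++ (s , 0) ∷ (suc s , 0) ∷ [])     ≡⟨ cong (fromMaybe _) (mergeRightmost-leaves ds s (suc s)) ⟩
  ds ++ [ dilate (toℕ j , 0) ]                     ≡⟨ map-++ dilate (UMMBᵇ j) [ (toℕ j , 0) ] ⟨
  map dilate (UMMBᵇ j ++ [ (toℕ j , 0) ])          ∎
  where
  open ≡-Reasoning
  s : ℕ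
  s = 2 * toℕ j
  ds : List Mountain
  ds = map dilate (UMMBᵇ j)
appendLeaf-UMMBᵇ 2[1+ j ] = begin
  appendLeaf (2 * suc t) (map dilate js)
    ≡⟨ appendLeaf≡mergeStep (2 * suc t) (map dilate js) ⟩
  mergeStep (map dilate js ++ [ (2 * suc t , 0) ])
    ≡⟨ mergeStep-dilate js (2 * suc t) ⟩
  map dilate (mergeStep js) ++ [ (2 * suc t , 0) ]
    ≡⟨ cong₂ (λ ys u → map dilate ys ++ [ (2 * u , 0) ]) (appendLeaf≡mergeStep t (UMMBᵇ j)) (toℕ-suc j) ⟨
  map dilate (appendLeaf t (UMMBᵇ j)) ++ [ (2 * toℕ (Bin.suc j) , 0) ]
    ≡⟨ cong (λ ys → map dilate ys ++ [ (2 * toℕ (Bin.suc j) , 0) ]) (appendLeaf-UMMBᵇ j) ⟩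
  map dilate (UMMBᵇ (Bin.suc j)) ++ [ (2 * toℕ (Bin.suc j) , 0) ] ∎
  where
  open ≡-Reasoning
  t : ℕ
  t = toℕ j
  js : List Mountain
  js = UMMBᵇ j ++ [ (t , 0) ]

UMMB≡UMMBᵇ : ∀ n → UMMB n ≡ UMMBᵇ (fromℕ' n)
UMMB≡UMMBᵇ zero    = refl
UMMB≡UMMBᵇ (suc n) = begin
  appendLeaf n (UMMB n)                          ≡⟨ cong (appendLeaf n) (UMMB≡UMMBᵇ n) ⟩
  appendLeaf n (UMMBᵇ (fromℕ' n))                ≡⟨ cong (λ i → appendLeaf i (UMMBᵇ (fromℕ' n))) (toℕ-fromℕ' n) ⟨
  appendLeaf (toℕ (fromℕ' n)) (UMMBᵇ (fromℕ' n)) ≡⟨ appendLeaf-UMMBᵇ (fromℕ' n) ⟩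
  UMMBᵇ (Bin.suc (fromℕ' n))                     ∎
  where open ≡-Reasoning

halve : ℕᵇ → ℕᵇ
halve Bin.zero = Bin.zero
halve 1+[2 j ] = j
halve 2[1+ j ] = j

trailingPeak : ℕᵇ → List Mountain
trailingPeak Bin.zero = []
trailingPeak 1+[2 j ] = [ (2 * toℕ j , 0) ]
trailingPeak 2[1+ j ] = [ dilate (toℕ j , 0) ]

length-trailingPeak : ∀ b → length (trailingPeak b) ≤ 1
length-trailingPeak Bin.zero = z≤n
length-trailingPeak 1+[2 j ] = ≤-refl
length-trailingPeak 2[1+ j ] = ≤-refl

UMMBᵇ-halve : ∀ b → UMMBᵇ b ≡ map dilate (UMMBᵇ (halve b)) ++ trailingPeak b
UMMBᵇ-halve Bin.zero = refl
UMMBᵇ-halve 1+[2 j ] = refl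
UMMBᵇ-halve 2[1+ j ] = map-++ dilate (UMMBᵇ j) [ (toℕ j , 0) ]

peakDiff-halve : ∀ a b → peakDiff (UMMBᵇ a) (UMMBᵇ b) ≤ 2 + peakDiff (UMMBᵇ (halve a)) (UMMBᵇ (halve b))
peakDiff-halve a b = begin
  peakDiff (UMMBᵇ a) (UMMBᵇ b)
    ≡⟨ cong₂ peakDiff (UMMBᵇ-halve a) (UMMBᵇ-halve b) ⟩
  peakDiff (map dilate as ++ trailingPeak a) (map dilate bs ++ trailingPeak b)
    ≤⟨ peakDiff-++ʳ (map dilate as) (trailingPeak a) (map dilate bs) (trailingPeak b) ⟩
  peakDiff (map dilate as) (map dilate bs) + (length (trailingPeak a) + length (trailingPeak b))
    ≤⟨ +-monoʳ-≤ _ (+-mono-≤ (length-trailingPeak a) (length-trailingPeak b)) ⟩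
  peakDiff (map dilate as) (map dilate bs) + 2
    ≡⟨ +-comm _ 2 ⟩
  2 + peakDiff (map dilate as) (map dilate bs)
    ≡⟨ cong (2 +_) (peakDiff-map dilate-injective as bs) ⟩
  2 + peakDiff as bs ∎
  where
  open ≤-Reasoning
  as bs : List Mountain
  as = UMMBᵇ (halve a)
  bs = UMMBᵇ (halve b)

peakDiff-suc : ∀ b → peakDiff (UMMBᵇ b) (UMMBᵇ (Bin.suc b)) ≤ 4
peakDiff-suc Bin.zero = s≤s z≤n
peakDiff-suc 1+[2 j ] = begin
  peakDiff (ds ++ [ (2 * toℕ j , 0) ]) (map dilate (UMMBᵇ j ++ [ (toℕ j , 0) ]))
    ≡⟨ cong (peakDiff _) (map-++ dilate (UMMBᵇ j) [ (toℕ j , 0) ]) ⟩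
  peakDiff (ds ++ [ (2 * toℕ j , 0) ]) (ds ++ [ dilate (toℕ j , 0) ])
    ≤⟨ peakDiff-++ʳ ds _ ds _ ⟩
  peakDiff ds ds + 2
    ≡⟨ cong (_+ 2) (peakDiff-self ds) ⟩
  2 ≤⟨ m≤m+n 2 2 ⟩
  4 ∎
  where
  open ≤-Reasoning
  ds : List Mountain
  ds = map dilate (UMMBᵇ j)
peakDiff-suc 2[1+ j ] = begin
  peakDiff (map dilate js) (UMMBᵇ 1+[2 Bin.suc j ])
    ≡⟨ cong₂ (λ xs ys → peakDiff xs (map dilate ys ++ [ leaf ])) (++-identityʳ (map dilate js)) next ⟨
  peakDiff (map dilate js ++ []) (map dilate (mergeStep js) ++ [ leaf ])
    ≤⟨ peakDiff-++ʳ (map dilate js) [] (map dilate (mergeStep js)) [ leaf ] ⟩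
  peakDiff (map dilate js) (map dilate (mergeStep js)) + 1
    ≡⟨ cong (_+ 1) (peakDiff-map dilate-injective js (mergeStep js)) ⟩
  peakDiff js (mergeStep js) + 1
    ≤⟨ +-monoˡ-≤ 1 (peakDiff-mergeStep js) ⟩
  4 ∎
  where
  open ≤-Reasoning
  js : List Mountain
  js = UMMBᵇ j ++ [ (toℕ j , 0) ]
  leaf : Mountain
  leaf = 2 * toℕ (Bin.suc j) , 0
  next : mergeStep js ≡ UMMBᵇ (Bin.suc j)
  next = trans (sym (appendLeaf≡mergeStep (toℕ j) (UMMBᵇ j))) (appendLeaf-UMMBᵇ j)

toℕ-halve : ∀ b → toℕ (halve b) ≡ ⌊ pred (toℕ b) /2⌋
toℕ-halve Bin.zero = refl
toℕ-halve 1+[2 j ] = begin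
  toℕ j                   ≡⟨ +-identityʳ (toℕ j) ⟨
  toℕ j + ⌊ 0 /2⌋         ≡⟨ ⌊2m+n/2⌋≡m+⌊n/2⌋ (toℕ j) 0 ⟨
  ⌊ 2 * toℕ j + 0 /2⌋     ≡⟨ cong ⌊_/2⌋ (+-identityʳ (2 * toℕ j)) ⟩
  ⌊ 2 * toℕ j /2⌋         ∎
  where open ≡-Reasoning
toℕ-halve 2[1+ j ] = begin
  toℕ j                   ≡⟨ +-identityʳ (toℕ j) ⟨
  toℕ j + ⌊ 1 /2⌋         ≡⟨ ⌊2m+n/2⌋≡m+⌊n/2⌋ (toℕ j) 1 ⟨
  ⌊ 2 * toℕ j + 1 /2⌋     ≡⟨ cong ⌊_/2⌋ (+-comm (2 * toℕ j) 1) ⟩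
  ⌊ pred (2 + 2 * toℕ j) /2⌋ ≡⟨ cong (λ k → ⌊ pred k /2⌋) (*-suc 2 (toℕ j)) ⟨
  ⌊ pred (2 * suc (toℕ j)) /2⌋ ∎
  where open ≡-Reasoning

toℕ-halve-mono : ∀ a b → toℕ a ≤ toℕ b → toℕ (halve a) ≤ toℕ (halve b)
toℕ-halve-mono a b a≤b rewrite toℕ-halve a | toℕ-halve b = ⌊n/2⌋-mono (pred-mono-≤ a≤b)

toℕ-halve-gap : ∀ e a b → toℕ b ≤ 2 ^ suc e + toℕ a → toℕ (halve b) ≤ 2 ^ e + toℕ (halve a)
toℕ-halve-gap e a b b≤2^[1+e]+a rewrite toℕ-halve a | toℕ-halve b = begin
  ⌊ pred (toℕ b) /2⌋                 ≤⟨ ⌊n/2⌋-mono (pred-mono-≤ b≤2^[1+e]+a) ⟩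
  ⌊ pred (2 * 2 ^ e + toℕ a) /2⌋     ≤⟨ ⌊n/2⌋-mono (pred[m+n]≤m+pred[n] (2 * 2 ^ e) (toℕ a)) ⟩
  ⌊ 2 * 2 ^ e + pred (toℕ a) /2⌋     ≡⟨ ⌊2m+n/2⌋≡m+⌊n/2⌋ (2 ^ e) (pred (toℕ a)) ⟩
  2 ^ e + ⌊ pred (toℕ a) /2⌋         ∎
  where open ≤-Reasoning

peakDiff-UMMBᵇ : ∀ e a b → toℕ a ≤ toℕ b → toℕ b ≤ 2 ^ e + toℕ a →
                 peakDiff (UMMBᵇ a) (UMMBᵇ b) ≤ 4 + 2 * e
peakDiff-UMMBᵇ zero a b a≤b b≤1+a with m≤n⇒m<n∨m≡n b≤1+a
... | inj₂ b≡1+a rewrite toℕ-injective {b} {Bin.suc a} (trans b≡1+a (sym (toℕ-suc a))) =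
  peakDiff-suc a
... | inj₁ b<1+a rewrite toℕ-injective {a} {b} (≤-antisym a≤b (s≤s⁻¹ b<1+a)) =
  ≤-trans (≤-reflexive (peakDiff-self (UMMBᵇ b))) z≤n
peakDiff-UMMBᵇ (suc e) a b a≤b b≤2^[1+e]+a = begin
  peakDiff (UMMBᵇ a) (UMMBᵇ b)
    ≤⟨ peakDiff-halve a b ⟩
  2 + peakDiff (UMMBᵇ (halve a)) (UMMBᵇ (halve b))
    ≤⟨ +-monoʳ-≤ 2 (peakDiff-UMMBᵇ e (halve a) (halve b) (toℕ-halve-mono a b a≤b) (toℕ-halve-gap e a b b≤2^[1+e]+a)) ⟩
  4 + (2 + 2 * e)
    ≡⟨ cong (4 +_) (*-suc 2 e) ⟨
  4 + 2 * suc e ∎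
  where open ≤-Reasoning

lemma6 : ∃[ C ] ((m n : ℕ) → m < n →
           peakDiff (UMMB m) (UMMB n) ≤ C * (1 + ⌊log₂ (n ∸ m) ⌋))
lemma6 = 6 , bound
  where
  bound : (m n : ℕ) → m < n → peakDiff (UMMB m) (UMMB n) ≤ 6 * (1 + ⌊log₂ (n ∸ m) ⌋)
  bound m n m<n = begin
    peakDiff (UMMB m) (UMMB n)                       ≡⟨ cong₂ peakDiff (UMMB≡UMMBᵇ m) (UMMB≡UMMBᵇ n) ⟩
    peakDiff (UMMBᵇ (fromℕ' m)) (UMMBᵇ (fromℕ' n))   ≤⟨ peakDiff-UMMBᵇ (suc L) (fromℕ' m) (fromℕ' n) m≤n n≤2^[1+L]+m ⟩
    4 + 2 * suc L                                    ≤⟨ +-monoˡ-≤ (2 * suc L) (m≤m*n 4 (suc L)) ⟩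
    4 * suc L + 2 * suc L                            ≡⟨ *-distribʳ-+ (suc L) 4 2 ⟨
    6 * (1 + L)                                      ∎
    where
    open ≤-Reasoning
    L : ℕ
    L = ⌊log₂ (n ∸ m) ⌋
    m≤n : toℕ (fromℕ' m) ≤ toℕ (fromℕ' n)
    m≤n rewrite toℕ-fromℕ' m | toℕ-fromℕ' n = <⇒≤ m<n
    n≤2^[1+L]+m : toℕ (fromℕ' n) ≤ 2 ^ suc L + toℕ (fromℕ' m)
    n≤2^[1+L]+m rewrite toℕ-fromℕ' m | toℕ-fromℕ' n = begin
      n                 ≡⟨ m∸n+n≡m (<⇒≤ m<n) ⟨
      n ∸ m + m         ≤⟨ +-monoˡ-≤ m (<⇒≤ (n<2^[1+⌊log₂n⌋] (n ∸ m))) ⟩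
      2 ^ suc L + m     ∎
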